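{- A nonempty mobile set exists in $E^n$ if and only if $n$ is odd, and a nonempty extended mobile set exists in $E^n$ if and only if $n$ is even.
   Context: $E^n$ denotes the set of binary words of length $n$ with the Hamming metric $d$; $|x|$ is the sum of coordinates of $x$ modulo $2$. A set $M\subseteq E^n$ is a $1$-code if the balls of radius $1$ centered at distinct elements of $M$ are pairwise disjoint; $\Omega(M)=\{x\in E^n: d(x,M)\le 1\}$. A set $M$ is a mobile set if it is a $1$-code and there is a $1$-code $M'$ with $M\cap M'=\emptyset$ and $\Omega(M)=\Omega(M')$. The extension of $M\subseteq E^n$ is $\{(x,|x|):x\in M\}$ or $\{(x,|x|\oplus1):x\in M\}$ in $E^{n+1}$; an extended mobile set is the extension of a mobile set. -}

module Defs where

open import Data.Bool using (Bool; true; false; _xor_)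
open import Data.Nat using (ℕ; zero; suc; _+_; _*_; _≤_)
open import Data.Vec using (Vec; []; _∷_; _∷ʳ_)
open import Data.Product using (Σ; _×_; ∃; _,_)
open import Data.Empty using (⊥)
open import Relation.Binary.PropositionalEquality using (_≡_; _≢_)
open import Relation.Nullary using (¬_)
open import Function.Bundles using (_⇔_)

E : ℕ → Set
E n = Vec Bool n

SubsetE : ℕ → Set
SubsetE n = E n → Bool

_∈_ : {n : ℕ} → E n → SubsetE n → Set
x ∈ M = M x ≡ true

d : {n : ℕ} → E n → E n → ℕ
d []       []       = 0
d (a ∷ x) (b ∷ y) = (if-xor a b) + d x y
  where
  if-xor : Bool → Bool → ℕ
  if-xor true  false = 1
  if-xor false true  = 1
  if-xor _     _     = 0

∣_∣₂ : {n : ℕ} → E n → Bool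
∣ [] ∣₂    = false
∣ a ∷ x ∣₂ = a xor ∣ x ∣₂

IsOneCode : {n : ℕ} → SubsetE n → Set
IsOneCode {n} M = (x y : E n) → x ∈ M → y ∈ M → x ≢ y →
  ¬ (Σ (E n) λ z → (d x z ≤ 1) × (d y z ≤ 1))

Ω : {n : ℕ} → SubsetE n → E n → Set
Ω {n} M z = Σ (E n) λ x → x ∈ M × (d x z ≤ 1)

IsMobile : {n : ℕ} → SubsetE n → Set
IsMobile {n} M = IsOneCode M × Σ (SubsetE n) λ M' →
  IsOneCode M' × ((x : E n) → ¬ (x ∈ M × x ∈ M')) × ((z : E n) → Ω M z ⇔ Ω M' z)

Extension : {m : ℕ} → Bool → SubsetE m → E (suc m) → Set
Extension {m} b M y = Σ (E m) λ x → x ∈ M × (y ≡ x ∷ʳ (∣ x ∣₂ xor b))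

IsExtendedMobile : {m : ℕ} → SubsetE (suc m) → Set
IsExtendedMobile {m} N = Σ (SubsetE m) λ M → Σ Bool λ b →
  IsMobile M × ((y : E (suc m)) → y ∈ N ⇔ Extension b M y)

Nonempty : {n : ℕ} → SubsetE n → Set
Nonempty {n} M = Σ (E n) λ x → x ∈ M

Even : ℕ → Set
Even n = Σ ℕ λ k → n ≡ 2 * k

Odd : ℕ → Set
Odd n = Σ ℕ λ k → n ≡ suc (2 * k)

-- Necessity: pick x ∈ M. Every word p of the unit ball around x is covered by a
-- unique y ∈ M' (M' is a 1-code), and y ≠ x since M and M' are disjoint. The
-- reflection p ↦ x ⊕ y ⊕ p stays in the ball, is covered by the same y, and so is
-- a fixed-point-free involution of the ball; hence the ball size n + 1 is even.
-- Sufficiency: {0} and {1} are a mobile pair in E¹, and a mobile pair (M, M') in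
-- Eⁿ yields the mobile pair (00M ∪ 11M', 00M' ∪ 11M) in Eⁿ⁺². Extending a set
-- preserves nonemptiness and raises the length by one, which gives the second part.
module Submission where

open import Defs
open import Data.Bool using (Bool; true; false; not; _xor_; if_then_else_)
open import Data.Bool.Properties using (xor-assoc; xor-comm; xor-same; not-¬)
  renaming (_≟_ to _≟ᵇ_)
open import Data.Empty using (⊥-elim)
open import Data.Fin using (Fin; zero; suc; punchIn; punchOut)
open import Data.Fin.Properties
  using (suc-injective; 0≢1+n; punchIn-injective; punchInᵢ≢i; punchIn-punchOut)
open import Data.Nat using (ℕ; zero; suc; pred; _*_; _≤_; z≤n; s≤s)
open import Data.Nat.Properties using (≤-trans; ≤-refl; n≤1+n; *-suc)
open import Data.Product using (Σ; _×_; _,_; proj₁; proj₂)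
open import Data.Vec using ([]; _∷_; _∷ʳ_; head; tail; init; last; initLast; _[_]%=_)
open import Data.Vec.Properties using (≡-dec; init-∷ʳ; last-∷ʳ)
open import Function using (_∘_)
open import Function.Bundles using (_⇔_; mk⇔; Equivalence)
open import Relation.Binary.PropositionalEquality
open import Relation.Nullary using (¬_; yes; no; does)
open import Relation.Nullary.Decidable using (decidable-stable; dec-true)

private
  variable
    n : ℕ

even⇒even-suc-suc : Even n → Even (suc (suc n))
even⇒even-suc-suc (k , n≡2k) = suc k , trans (cong (λ m → suc (suc m)) n≡2k) (sym (*-suc 2 k))

even-suc⇒odd : Even (suc n) → Odd n
even-suc⇒odd (zero , ())
even-suc⇒odd (suc k , e) = k , cong pred (trans e (*-suc 2 k))

odd⇒even-suc : Odd n → Even (suc n)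
odd⇒even-suc (k , e) = suc k , trans (cong suc e) (sym (*-suc 2 k))

-- Fixed-point-free involutions of Fin m

module Restriction {m : ℕ} (τ : Fin (suc (suc m)) → Fin (suc (suc m)))
                   (τ-involutive : ∀ i → τ (τ i) ≡ i)
                   {k : Fin (suc m)} (τ0≡suc-k : τ zero ≡ suc k) where

  -- embed enumerates Fin (2 + m) without zero and suc k, a τ-invariant pair.
  embed : Fin m → Fin (suc (suc m))
  embed i = suc (punchIn k i)

  embed-injective : ∀ {i j} → embed i ≡ embed j → i ≡ j
  embed-injective e = punchIn-injective _ _ _ (suc-injective e)

  τ-injective : ∀ {i j} → τ i ≡ τ j → i ≡ j
  τ-injective {i} {j} e = trans (sym (τ-involutive i)) (trans (cong τ e) (τ-involutive j))

  τ-embed≢zero : ∀ i → τ (embed i) ≢ zero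
  τ-embed≢zero i e =
    punchInᵢ≢i k i (suc-injective (trans (trans (sym (τ-involutive _)) (cong τ e)) τ0≡suc-k))

  τ-embed≢suc-k : ∀ i → τ (embed i) ≢ suc k
  τ-embed≢suc-k i e = 0≢1+n (sym (τ-injective (trans e (sym τ0≡suc-k))))

  unembed : (j : Fin (suc (suc m))) → j ≢ zero → j ≢ suc k → Fin m
  unembed zero    j≢0 _       = ⊥-elim (j≢0 refl)
  unembed (suc j) _   j≢suc-k = punchOut (j≢suc-k ∘ cong suc ∘ sym)

  embed-unembed : ∀ j j≢0 j≢suc-k → embed (unembed j j≢0 j≢suc-k) ≡ j
  embed-unembed zero    j≢0 _ = ⊥-elim (j≢0 refl)
  embed-unembed (suc j) _   _ = cong suc (punchIn-punchOut _)

  restriction : Fin m → Fin m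
  restriction i = unembed (τ (embed i)) (τ-embed≢zero i) (τ-embed≢suc-k i)

  embed-restriction : ∀ i → embed (restriction i) ≡ τ (embed i)
  embed-restriction i = embed-unembed _ _ _

  restriction-involutive : ∀ i → restriction (restriction i) ≡ i
  restriction-involutive i = embed-injective (begin
    embed (restriction (restriction i)) ≡⟨ embed-restriction _ ⟩
    τ (embed (restriction i))           ≡⟨ cong τ (embed-restriction i) ⟩
    τ (τ (embed i))                     ≡⟨ τ-involutive _ ⟩
    embed i                             ∎)
    where open ≡-Reasoning

  restriction-fixedPointFree : (∀ j → τ j ≢ j) → ∀ i → restriction i ≢ i
  restriction-fixedPointFree τ-fpf i e =
    τ-fpf (embed i) (trans (sym (embed-restriction i)) (cong embed e))

fixedPointFree-involution⇒even : ∀ m (τ : Fin m → Fin m) →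
  (∀ i → τ (τ i) ≡ i) → (∀ i → τ i ≢ i) → Even m
fixedPointFree-involution⇒even zero _ _ _ = 0 , refl
fixedPointFree-involution⇒even (suc zero) τ _ τ-fpf with τ zero in τ0
... | zero = ⊥-elim (τ-fpf zero τ0)
fixedPointFree-involution⇒even (suc (suc m)) τ τ-inv τ-fpf with τ zero in τ0
... | zero  = ⊥-elim (τ-fpf zero τ0)
... | suc k = even⇒even-suc-suc
  (fixedPointFree-involution⇒even m restriction restriction-involutive
    (restriction-fixedPointFree τ-fpf))
  where open Restriction τ τ-inv τ0

d-self : (x : E n) → d x x ≡ 0
d-self []          = refl
d-self (false ∷ x) = d-self x
d-self (true ∷ x)  = d-self x

d-tail≤ : ∀ a b (x y : E n) → d x y ≤ d (a ∷ x) (b ∷ y)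
d-tail≤ false false x y = ≤-refl
d-tail≤ true  true  x y = ≤-refl
d-tail≤ false true  x y = n≤1+n _
d-tail≤ true  false x y = n≤1+n _

d-drop₂≤1 : ∀ a b c e (x z : E n) → d (a ∷ b ∷ x) (c ∷ e ∷ z) ≤ 1 → d x z ≤ 1
d-drop₂≤1 a b c e x z p =
  ≤-trans (≤-trans (d-tail≤ b e x z) (d-tail≤ a c (b ∷ x) (e ∷ z))) p

d≤0⇒≡ : (x y : E n) → d x y ≤ 0 → x ≡ y
d≤0⇒≡ []          []          _ = refl
d≤0⇒≡ (false ∷ x) (false ∷ y) p = cong (false ∷_) (d≤0⇒≡ x y p)
d≤0⇒≡ (true ∷ x)  (true ∷ y)  p = cong (true ∷_) (d≤0⇒≡ x y p)
d≤0⇒≡ (false ∷ x) (true ∷ y)  ()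
d≤0⇒≡ (true ∷ x)  (false ∷ y) ()

d-flip : (x : E n) (i : Fin n) → d x (x [ i ]%= not) ≡ 1
d-flip (false ∷ x) zero    = cong suc (d-self x)
d-flip (true ∷ x)  zero    = cong suc (d-self x)
d-flip (false ∷ x) (suc i) = d-flip x i
d-flip (true ∷ x)  (suc i) = d-flip x i

ball : E n → Fin (suc n) → E n
ball x zero    = x
ball x (suc i) = x [ i ]%= not

ballIndex : E n → E n → Fin (suc n)
ballIndex []          []          = zero
ballIndex (false ∷ x) (false ∷ z) = punchIn (suc zero) (ballIndex x z)
ballIndex (true ∷ x)  (true ∷ z)  = punchIn (suc zero) (ballIndex x z)
ballIndex (false ∷ x) (true ∷ z)  = suc zero
ballIndex (true ∷ x)  (false ∷ z) = suc zero

d-ball≤1 : (x : E n) (q : Fin (suc n)) → d x (ball x q) ≤ 1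
d-ball≤1 x zero    rewrite d-self x  = z≤n
d-ball≤1 x (suc i) rewrite d-flip x i = ≤-refl

ballIndex-self : (x : E n) → ballIndex x x ≡ zero
ballIndex-self []          = refl
ballIndex-self (false ∷ x) rewrite ballIndex-self x = refl
ballIndex-self (true ∷ x)  rewrite ballIndex-self x = refl

ballIndex-ball : (x : E n) (q : Fin (suc n)) → ballIndex x (ball x q) ≡ q
ballIndex-ball x           zero          = ballIndex-self x
ballIndex-ball (false ∷ x) (suc zero)    = refl
ballIndex-ball (true ∷ x)  (suc zero)    = refl
ballIndex-ball (false ∷ x) (suc (suc i)) rewrite ballIndex-ball x (suc i) = refl
ballIndex-ball (true ∷ x)  (suc (suc i)) rewrite ballIndex-ball x (suc i) = refl

ball-cons : ∀ a (x : E n) q → ball (a ∷ x) (punchIn (suc zero) q) ≡ a ∷ ball x q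
ball-cons a x zero    = refl
ball-cons a x (suc i) = refl

ball-ballIndex : (x z : E n) → d x z ≤ 1 → ball x (ballIndex x z) ≡ z
ball-ballIndex []          []          _ = refl
ball-ballIndex (false ∷ x) (false ∷ z) p =
  trans (ball-cons false x (ballIndex x z)) (cong (false ∷_) (ball-ballIndex x z p))
ball-ballIndex (true ∷ x)  (true ∷ z)  p =
  trans (ball-cons true x (ballIndex x z)) (cong (true ∷_) (ball-ballIndex x z p))
ball-ballIndex (false ∷ x) (true ∷ z)  (s≤s p) = cong (true ∷_) (d≤0⇒≡ x z p)
ball-ballIndex (true ∷ x)  (false ∷ z) (s≤s p) = cong (false ∷_) (d≤0⇒≡ x z p)

reflect : E n → E n → E n → E n
reflect []      []      []      = []
reflect (a ∷ x) (b ∷ y) (c ∷ z) = ((a xor b) xor c) ∷ reflect x y z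

reflect-comm : (x y z : E n) → reflect x y z ≡ reflect y x z
reflect-comm []      []      []      = refl
reflect-comm (a ∷ x) (b ∷ y) (c ∷ z) =
  cong₂ _∷_ (cong (_xor c) (xor-comm a b)) (reflect-comm x y z)

reflect-involutive : (x y z : E n) → reflect x y (reflect x y z) ≡ z
reflect-involutive []      []      []      = refl
reflect-involutive (a ∷ x) (b ∷ y) (c ∷ z) = cong₂ _∷_ bit (reflect-involutive x y z)
  where
  bit : ((a xor b) xor ((a xor b) xor c)) ≡ c
  bit = trans (sym (xor-assoc (a xor b) (a xor b) c)) (cong (_xor c) (xor-same (a xor b)))

reflect-fixed⇒≡ : (x y z : E n) → reflect x y z ≡ z → x ≡ y
reflect-fixed⇒≡ []      []      []      _ = refl
reflect-fixed⇒≡ (a ∷ x) (b ∷ y) (c ∷ z) e =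
  cong₂ _∷_ (bit a b (cong head e)) (reflect-fixed⇒≡ x y z (cong tail e))
  where
  bit : ∀ a b → ((a xor b) xor c) ≡ c → a ≡ b
  bit false false _ = refl
  bit true  true  _ = refl
  bit false true  e = ⊥-elim (not-¬ {c} refl (sym e))
  bit true  false e = ⊥-elim (not-¬ {c} refl (sym e))

d-reflectˡ : (x y z : E n) → d x (reflect x y z) ≡ d y z
d-reflectˡ []          []          []          = refl
d-reflectˡ (false ∷ x) (false ∷ y) (false ∷ z) = d-reflectˡ x y z
d-reflectˡ (false ∷ x) (false ∷ y) (true ∷ z)  = cong suc (d-reflectˡ x y z)
d-reflectˡ (false ∷ x) (true ∷ y)  (false ∷ z) = cong suc (d-reflectˡ x y z)
d-reflectˡ (false ∷ x) (true ∷ y)  (true ∷ z)  = d-reflectˡ x y z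
d-reflectˡ (true ∷ x)  (false ∷ y) (false ∷ z) = d-reflectˡ x y z
d-reflectˡ (true ∷ x)  (false ∷ y) (true ∷ z)  = cong suc (d-reflectˡ x y z)
d-reflectˡ (true ∷ x)  (true ∷ y)  (false ∷ z) = cong suc (d-reflectˡ x y z)
d-reflectˡ (true ∷ x)  (true ∷ y)  (true ∷ z)  = d-reflectˡ x y z

d-reflectʳ : (x y z : E n) → d y (reflect x y z) ≡ d x z
d-reflectʳ x y z = trans (cong (d y) (reflect-comm x y z)) (d-reflectˡ y x z)

-- Necessity

Disjoint : SubsetE n → SubsetE n → Set
Disjoint {n} M M' = (x : E n) → ¬ (x ∈ M × x ∈ M')

oneCode-unique : {M : SubsetE n} → IsOneCode M → ∀ {x y z} →
  x ∈ M → y ∈ M → d x z ≤ 1 → d y z ≤ 1 → x ≡ y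
oneCode-unique code x∈M y∈M dx dy =
  decidable-stable (≡-dec _≟ᵇ_ _ _) (λ x≢y → code _ _ x∈M y∈M x≢y (_ , dx , dy))

module Mirror {M M' : SubsetE n} (M'-oneCode : IsOneCode M') (disjoint : Disjoint M M')
              (Ω⊆Ω' : ∀ z → Ω M z → Ω M' z) {x : E n} (x∈M : x ∈ M) where

  cover : (q : Fin (suc n)) → Ω M' (ball x q)
  cover q = Ω⊆Ω' _ (x , x∈M , d-ball≤1 x q)

  coverer : Fin (suc n) → E n
  coverer q = proj₁ (cover q)

  coverer∈M' : ∀ q → coverer q ∈ M'
  coverer∈M' q = proj₁ (proj₂ (cover q))

  d-coverer≤1 : ∀ q → d (coverer q) (ball x q) ≤ 1
  d-coverer≤1 q = proj₂ (proj₂ (cover q))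

  mirror : Fin (suc n) → Fin (suc n)
  mirror q = ballIndex x (reflect x (coverer q) (ball x q))

  ball-mirror : ∀ q → ball x (mirror q) ≡ reflect x (coverer q) (ball x q)
  ball-mirror q = ball-ballIndex x _
    (subst (_≤ 1) (sym (d-reflectˡ x (coverer q) (ball x q))) (d-coverer≤1 q))

  coverer-mirror : ∀ q → coverer (mirror q) ≡ coverer q
  coverer-mirror q = oneCode-unique M'-oneCode (coverer∈M' (mirror q)) (coverer∈M' q)
    (subst (λ w → d (coverer (mirror q)) w ≤ 1) (ball-mirror q) (d-coverer≤1 (mirror q)))
    (subst (_≤ 1) (sym (d-reflectʳ x (coverer q) (ball x q))) (d-ball≤1 x q))

  mirror-involutive : ∀ q → mirror (mirror q) ≡ q
  mirror-involutive q = begin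
    ballIndex x (reflect x (coverer (mirror q)) (ball x (mirror q)))
      ≡⟨ cong₂ (λ y w → ballIndex x (reflect x y w)) (coverer-mirror q) (ball-mirror q) ⟩
    ballIndex x (reflect x (coverer q) (reflect x (coverer q) (ball x q)))
      ≡⟨ cong (ballIndex x) (reflect-involutive x (coverer q) (ball x q)) ⟩
    ballIndex x (ball x q)
      ≡⟨ ballIndex-ball x q ⟩
    q ∎
    where open ≡-Reasoning

  mirror-fixedPointFree : ∀ q → mirror q ≢ q
  mirror-fixedPointFree q e = disjoint x (x∈M , subst (_∈ M') (sym x≡coverer) (coverer∈M' q))
    where
    x≡coverer : x ≡ coverer q
    x≡coverer = reflect-fixed⇒≡ x (coverer q) (ball x q)
      (trans (sym (ball-mirror q)) (cong (ball x) e))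

mobile⇒odd : {M : SubsetE n} → IsMobile M → Nonempty M → Odd n
mobile⇒odd {n} (_ , M' , M'-oneCode , disjoint , sameΩ) (x , x∈M) =
  even-suc⇒odd (fixedPointFree-involution⇒even (suc n) mirror mirror-involutive
                                                mirror-fixedPointFree)
  where open Mirror M'-oneCode disjoint (λ z → Equivalence.to (sameΩ z)) x∈M

-- Sufficiency

NonemptyMobile : ℕ → Set
NonemptyMobile n = Σ (SubsetE n) λ M → IsMobile M × Nonempty M

nonemptyMobile-1 : NonemptyMobile 1
nonemptyMobile-1 =
  M₀ , (M₀-oneCode , M₁ , M₁-oneCode , disjoint , λ z → mk⇔ (Ω₀⊆Ω₁ z) (Ω₁⊆Ω₀ z)) ,
  (false ∷ [] , refl)
  where
  M₀ M₁ : SubsetE 1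
  M₀ (b ∷ []) = not b
  M₁ (b ∷ []) = b
  M₀-oneCode : IsOneCode M₀
  M₀-oneCode (false ∷ []) (false ∷ []) _  _  x≢y _ = x≢y refl
  M₀-oneCode (true ∷ [])  _            () _  _   _
  M₀-oneCode (false ∷ []) (true ∷ [])  _  () _   _
  M₁-oneCode : IsOneCode M₁
  M₁-oneCode (true ∷ [])  (true ∷ [])  _  _  x≢y _ = x≢y refl
  M₁-oneCode (false ∷ []) _            () _  _   _
  M₁-oneCode (true ∷ [])  (false ∷ []) _  () _   _
  disjoint : Disjoint M₀ M₁
  disjoint (false ∷ []) (_ , ())
  disjoint (true ∷ [])  (() , _)
  Ω₀⊆Ω₁ : ∀ z → Ω M₀ z → Ω M₁ z
  Ω₀⊆Ω₁ (false ∷ []) _ = true ∷ [] , refl , s≤s z≤n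
  Ω₀⊆Ω₁ (true ∷ [])  _ = true ∷ [] , refl , z≤n
  Ω₁⊆Ω₀ : ∀ z → Ω M₁ z → Ω M₀ z
  Ω₁⊆Ω₀ (false ∷ []) _ = false ∷ [] , refl , z≤n
  Ω₁⊆Ω₀ (true ∷ [])  _ = false ∷ [] , refl , s≤s z≤n

pairPrefix : SubsetE n → SubsetE n → SubsetE (suc (suc n))
pairPrefix M M' (false ∷ false ∷ x) = M x
pairPrefix M M' (true ∷ true ∷ x)   = M' x
pairPrefix M M' (false ∷ true ∷ x)  = false
pairPrefix M M' (true ∷ false ∷ x)  = false

shared-neighbour-00-11⇒≡ : (x y : E n) (z : E (suc (suc n))) →
  d (false ∷ false ∷ x) z ≤ 1 → d (true ∷ true ∷ y) z ≤ 1 → x ≡ y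
shared-neighbour-00-11⇒≡ x y (false ∷ false ∷ z) _ (s≤s ())
shared-neighbour-00-11⇒≡ x y (true ∷ true ∷ z) (s≤s ()) _
shared-neighbour-00-11⇒≡ x y (false ∷ true ∷ z) (s≤s p) (s≤s q) =
  trans (d≤0⇒≡ x z p) (sym (d≤0⇒≡ y z q))
shared-neighbour-00-11⇒≡ x y (true ∷ false ∷ z) (s≤s p) (s≤s q) =
  trans (d≤0⇒≡ x z p) (sym (d≤0⇒≡ y z q))

pairPrefix-oneCode : {M M' : SubsetE n} → IsOneCode M → IsOneCode M' → Disjoint M M' →
  IsOneCode (pairPrefix M M')
pairPrefix-oneCode code code' _ (false ∷ false ∷ x) (false ∷ false ∷ y) x∈ y∈ x≢y
  (c ∷ e ∷ z , p , q) =
  code x y x∈ y∈ (x≢y ∘ cong (λ v → false ∷ false ∷ v))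
    (z , d-drop₂≤1 false false c e x z p , d-drop₂≤1 false false c e y z q)
pairPrefix-oneCode code code' _ (true ∷ true ∷ x) (true ∷ true ∷ y) x∈ y∈ x≢y
  (c ∷ e ∷ z , p , q) =
  code' x y x∈ y∈ (x≢y ∘ cong (λ v → true ∷ true ∷ v))
    (z , d-drop₂≤1 true true c e x z p , d-drop₂≤1 true true c e y z q)
pairPrefix-oneCode {M' = M'} _ _ disjoint (false ∷ false ∷ x) (true ∷ true ∷ y) x∈ y∈ _
  (z , p , q) =
  disjoint x (x∈ , subst (_∈ M') (sym (shared-neighbour-00-11⇒≡ x y z p q)) y∈)
pairPrefix-oneCode {M' = M'} _ _ disjoint (true ∷ true ∷ x) (false ∷ false ∷ y) x∈ y∈ _
  (z , p , q) =
  disjoint y (y∈ , subst (_∈ M') (sym (shared-neighbour-00-11⇒≡ y x z q p)) x∈)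
pairPrefix-oneCode _ _ _ (false ∷ true ∷ x) _ () _ _ _
pairPrefix-oneCode _ _ _ (true ∷ false ∷ x) _ () _ _ _
pairPrefix-oneCode _ _ _ (false ∷ false ∷ x) (false ∷ true ∷ y) _ () _ _
pairPrefix-oneCode _ _ _ (false ∷ false ∷ x) (true ∷ false ∷ y) _ () _ _
pairPrefix-oneCode _ _ _ (true ∷ true ∷ x) (false ∷ true ∷ y) _ () _ _
pairPrefix-oneCode _ _ _ (true ∷ true ∷ x) (true ∷ false ∷ y) _ () _ _

pairPrefix-disjoint : {M M' : SubsetE n} → Disjoint M M' →
  Disjoint (pairPrefix M M') (pairPrefix M' M)
pairPrefix-disjoint disjoint (false ∷ false ∷ x) (x∈M , x∈M') = disjoint x (x∈M , x∈M')
pairPrefix-disjoint disjoint (true ∷ true ∷ x)   (x∈M' , x∈M) = disjoint x (x∈M , x∈M')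
pairPrefix-disjoint disjoint (false ∷ true ∷ x)  (() , _)
pairPrefix-disjoint disjoint (true ∷ false ∷ x)  (() , _)

-- A word with unequal leading bits is adjacent to both 00w and 11w, so it is
-- covered on both sides whenever it is covered at all.
pairPrefix-Ω : {M M' : SubsetE n} → (∀ w → Ω M w → Ω M' w) → (∀ w → Ω M' w → Ω M w) →
  ∀ z → Ω (pairPrefix M M') z → Ω (pairPrefix M' M) z
pairPrefix-Ω Ω⊆Ω' _ (false ∷ false ∷ w) (false ∷ false ∷ x , x∈ , p) =
  let (x' , x'∈ , p') = Ω⊆Ω' w (x , x∈ , p) in false ∷ false ∷ x' , x'∈ , p'
pairPrefix-Ω _ Ω'⊆Ω (true ∷ true ∷ w)   (true ∷ true ∷ x , x∈ , p) =
  let (x' , x'∈ , p') = Ω'⊆Ω w (x , x∈ , p) in true ∷ true ∷ x' , x'∈ , p'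
pairPrefix-Ω _ _ (false ∷ true ∷ w) (false ∷ false ∷ x , x∈ , p) = true ∷ true ∷ x , x∈ , p
pairPrefix-Ω _ _ (true ∷ false ∷ w) (false ∷ false ∷ x , x∈ , p) = true ∷ true ∷ x , x∈ , p
pairPrefix-Ω _ _ (false ∷ true ∷ w) (true ∷ true ∷ x , x∈ , p)   = false ∷ false ∷ x , x∈ , p
pairPrefix-Ω _ _ (true ∷ false ∷ w) (true ∷ true ∷ x , x∈ , p)   = false ∷ false ∷ x , x∈ , p
pairPrefix-Ω _ _ (true ∷ true ∷ w)   (false ∷ false ∷ x , _ , s≤s ())
pairPrefix-Ω _ _ (false ∷ false ∷ w) (true ∷ true ∷ x , _ , s≤s ())
pairPrefix-Ω _ _ _ (false ∷ true ∷ x , () , _)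
pairPrefix-Ω _ _ _ (true ∷ false ∷ x , () , _)

nonemptyMobile-+2 : NonemptyMobile n → NonemptyMobile (suc (suc n))
nonemptyMobile-+2 (M , (code , M' , code' , disjoint , sameΩ) , (x , x∈M)) =
  pairPrefix M M' ,
  (pairPrefix-oneCode code code' disjoint , pairPrefix M' M ,
   pairPrefix-oneCode code' code (λ y (y∈M' , y∈M) → disjoint y (y∈M , y∈M')) ,
   pairPrefix-disjoint disjoint ,
   λ z → mk⇔ (pairPrefix-Ω Ω⊆Ω' Ω'⊆Ω z) (pairPrefix-Ω Ω'⊆Ω Ω⊆Ω' z)) ,
  (false ∷ false ∷ x , x∈M)
  where
  Ω⊆Ω' : ∀ w → Ω M w → Ω M' w
  Ω⊆Ω' w = Equivalence.to (sameΩ w)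
  Ω'⊆Ω : ∀ w → Ω M' w → Ω M w
  Ω'⊆Ω w = Equivalence.from (sameΩ w)

nonemptyMobile-odd : ∀ k → NonemptyMobile (suc (2 * k))
nonemptyMobile-odd zero    = nonemptyMobile-1
nonemptyMobile-odd (suc k) =
  subst (NonemptyMobile ∘ suc) (sym (*-suc 2 k)) (nonemptyMobile-+2 (nonemptyMobile-odd k))

odd⇒nonemptyMobile : Odd n → NonemptyMobile n
odd⇒nonemptyMobile (k , refl) = nonemptyMobile-odd k

extension : Bool → SubsetE n → SubsetE (suc n)
extension b M y = if does (last y ≟ᵇ (∣ init y ∣₂ xor b)) then M (init y) else false

∈-extension⇔ : ∀ b (M : SubsetE n) y → y ∈ extension b M ⇔ Extension b M y
∈-extension⇔ b M y = mk⇔ to from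
  where
  to : y ∈ extension b M → Extension b M y
  to y∈ with last y ≟ᵇ (∣ init y ∣₂ xor b)
  ... | yes last≡ = init y , y∈ , trans (proj₂ (proj₂ (initLast y))) (cong (init y ∷ʳ_) last≡)
  to () | no _
  from : Extension b M y → y ∈ extension b M
  from (x , x∈M , refl)
    rewrite init-∷ʳ (∣ x ∣₂ xor b) x | last-∷ʳ (∣ x ∣₂ xor b) x
          | dec-true ((∣ x ∣₂ xor b) ≟ᵇ (∣ x ∣₂ xor b)) refl = x∈M

NonemptyExtendedMobile : ℕ → Set
NonemptyExtendedMobile m = Σ (SubsetE (suc m)) λ N → IsExtendedMobile N × Nonempty N

nonemptyExtendedMobile⇒even : ∀ {m} → NonemptyExtendedMobile m → Even (suc m)
nonemptyExtendedMobile⇒even (_ , (_ , _ , mobile , N⇔ext) , (y , y∈N)) =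
  let (x , x∈M , _) = Equivalence.to (N⇔ext y) y∈N in odd⇒even-suc (mobile⇒odd mobile (x , x∈M))

even⇒nonemptyExtendedMobile : ∀ {m} → Even (suc m) → NonemptyExtendedMobile m
even⇒nonemptyExtendedMobile even =
  let (M , mobile , (x , x∈M)) = odd⇒nonemptyMobile (even-suc⇒odd even) in
  extension false M , (M , false , mobile , ∈-extension⇔ false M) ,
  (_ , Equivalence.from (∈-extension⇔ false M _) (x , x∈M , refl))

corollary1 : ((n : ℕ) → (Σ (SubsetE n) λ M → IsMobile M × Nonempty M) ⇔ Odd n)
    × ((m : ℕ) → (Σ (SubsetE (suc m)) λ N → IsExtendedMobile N × Nonempty N) ⇔ Even (suc m))
corollary1 =
  (λ n → mk⇔ (λ (_ , mobile , nonempty) → mobile⇒odd mobile nonempty) odd⇒nonemptyMobile) ,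
  (λ m → mk⇔ nonemptyExtendedMobile⇒even even⇒nonemptyExtendedMobile)
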